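{- For integers $n\ge 1$ and $1\le k\le n$, the number of trees with distinguished children having $n$ nodes and exactly $k$ leaves equals $$\frac1n\binom{n}{k}\binom{2n-2-k}{k-1}.$$
   Context: An ordered (plane) tree consists of a root together with an ordered sequence of $m\ge 0$ subtrees, each of which is recursively an ordered tree. A tree with distinguished children is an ordered tree in which, for every node that has at least one child, exactly one of its children is designated as distinguished; two such trees are different if their underlying ordered trees differ or their choices of distinguished children differ. The size of a tree is its number of nodes. A leaf is a node with no children; in particular the tree consisting of a single node has exactly one leaf. Binomial coefficients $\binom{a}{b}$ with $b<0$ are $0$, and $\binom{a}{0}=1$ for every integer $a$. -}

module Defs where

open import Data.Nat using (ℕ; zero; suc; _+_)
open import Data.Fin using (Fin)
open import Data.Vec using (Vec; []; _∷_)

-- A node is either a leaf (no children), or has an ordered, nonempty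
-- sequence of  suc m  subtrees together with the position (Fin (suc m))
-- of its distinguished child.
data DTree : Set where
  leaf : DTree
  node : (m : ℕ) → Vec DTree (suc m) → Fin (suc m) → DTree

mutual
  size : DTree → ℕ
  size leaf = 1
  size (node m ts d) = suc (sizes ts)

  sizes : ∀ {m} → Vec DTree m → ℕ
  sizes [] = 0
  sizes (t ∷ ts) = size t + sizes ts

mutual
  leaves : DTree → ℕ
  leaves leaf = 1
  leaves (node m ts d) = leavesV ts

  leavesV : ∀ {m} → Vec DTree m → ℕ
  leavesV [] = 0
  leavesV (t ∷ ts) = leaves t + leavesV ts

-- A tree is encoded by the preorder list of its node types: a leaf, or m + 1 children of which
-- the d-th is distinguished. These Łukasiewicz codes are the words w with one letter more than
-- their total arity whose proper prefixes all have at least as much arity as letters. By the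
-- cycle lemma every word of length n and total arity n − 1 has exactly one rotation that is a
-- code, so n times the number of codes is the number of such balanced words. A balanced word
-- with k leaves is given by the positions of its leaves, C(n, k) choices, and its n − k node
-- types; writing each as the pair (d, m − d) turns these into a weak composition of k − 1 into
-- 2(n − k) parts, of which there are C(2n − 2 − k, k − 1).
module Submission where

open import Defs
open import Data.Nat using (ℕ; zero; suc; _+_; _*_; _∸_; _≤_; _<_; _/_; NonZero; z≤n; s≤s; s≤s⁻¹)
open import Data.Nat.Properties as ℕ using (+-suc; +-comm; suc-injective)
open import Data.Nat.Combinatorics using (_C_; nCk+nC[k+1]≡[n+1]C[k+1]; k>n⇒nCk≡0)
open import Data.Nat.DivMod using (m*n/n≡m)
open import Data.Bool using (Bool; true; false)
open import Data.Fin using (Fin; zero; suc; _≟_; toℕ; fromℕ<)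
open import Data.Fin.Properties using (+↔⊎; *↔×; 0↔⊥; 1↔⊤; toℕ<n; toℕ-fromℕ<; fromℕ<-toℕ; toℕ-injective)
open import Data.Fin.Permutation using (↔⇒≡)
open import Data.List using (List; []; _∷_; length; _++_; map; take; drop)
open import Data.List.Properties
  using (length-++; length-++-comm; length-++-≤ʳ; ++-assoc; ++-identityʳ; map-++; ∷-injective; length-take; take++drop≡id)
open import Data.Nat.ListAction.Properties using (sum-++)
open import Data.Vec using (Vec; []; _∷_; replicate; head) renaming (_++_ to _++ᵥ_; take to takeᵥ; drop to dropᵥ)
open import Data.Vec.Properties using (++-injective) renaming (take++drop≡id to take++drop≡idᵥ)
open import Data.Maybe using (Maybe; just; nothing)
import Data.Maybe.Properties as Maybe
open import Data.Nat.ListAction using (sum)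
open import Data.Sum using (_⊎_; inj₁; inj₂)
open import Data.Nat.Tactic.RingSolver using (solve-∀)
open import Data.Sum.Algebra using (⊎-cong)
open import Data.Product using (Σ; ∃-syntax; _×_; _,_; proj₁; proj₂)
open import Data.Product.Algebra using (×-cong)
open import Data.Empty using (⊥; ⊥-elim)
open import Data.Unit using (⊤)
open import Function using (_∘_; case_of_)
open import Function.Bundles using (_↔_; mk↔ₛ′; Inverse)
open import Function.Properties.Inverse using (↔-refl; ↔-sym; ↔-trans)
open import Function.Related.Propositional using (module EquationalReasoning)
open import Relation.Nullary using (yes; no)
open import Relation.Nullary.Irrelevant using (Irrelevant)
open import Relation.Unary using (Decidable)
open import Axiom.UniquenessOfIdentityProofs using (UIP; module Decidable⇒UIP)
open import Relation.Binary.PropositionalEquality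

private variable
  A B X : Set
  m n N k : ℕ

Σ-≡ : {P : A → Set} → (∀ {a} → Irrelevant (P a)) → {x y : Σ A P} → proj₁ x ≡ proj₁ y → x ≡ y
Σ-≡ irr {a , _} {.a , _} refl = cong (a ,_) (irr _ _)

×-irrelevant : Irrelevant A → Irrelevant B → Irrelevant (A × B)
×-irrelevant irrA irrB (a , b) (a′ , b′) = cong₂ _,_ (irrA a a′) (irrB b b′)

ℕ²-irrelevant : {a b c d : ℕ} → Irrelevant (a ≡ b × c ≡ d)
ℕ²-irrelevant = ×-irrelevant ℕ.≡-irrelevant ℕ.≡-irrelevant

Fin-cong : m ≡ n → Fin m ↔ Fin n
Fin-cong refl = ↔-refl

Fin-UIP : UIP (Fin n)
Fin-UIP = Decidable⇒UIP.≡-irrelevant _≟_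

-- Finite sets

Σ-Fin-suc : {P : Fin (suc N) → Set} → Σ (Fin (suc N)) P ↔ (P zero ⊎ Σ (Fin N) (P ∘ suc))
Σ-Fin-suc = mk↔ₛ′
  (λ { (zero , q) → inj₁ q ; (suc i , q) → inj₂ (i , q) })
  (λ { (inj₁ q) → zero , q ; (inj₂ (i , q)) → suc i , q })
  (λ { (inj₁ q) → refl ; (inj₂ (i , q)) → refl })
  (λ { (zero , q) → refl ; (suc i , q) → refl })

Σ-Fin-finite : ∀ N {P : Fin N → Set} → Decidable P → (∀ {i} → Irrelevant (P i)) →
               ∃[ m ] (Σ (Fin N) P ↔ Fin m)
Σ-Fin-finite zero P? irr =
  0 , mk↔ₛ′ (λ { (() , _) }) (λ ()) (λ ()) (λ { (() , _) })
Σ-Fin-finite (suc N) {P} P? irr with Σ-Fin-finite N (P? ∘ suc) irr | P? zero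
... | m , e | yes q = suc m , (begin
  Σ (Fin (suc N)) P              ↔⟨ Σ-Fin-suc ⟩
  (P zero ⊎ Σ (Fin N) (P ∘ suc)) ↔⟨ ⊎-cong (↔-trans P₀↔⊤ (↔-sym 1↔⊤)) e ⟩
  (Fin 1 ⊎ Fin m)                ↔⟨ +↔⊎ ⟨
  Fin (suc m)                    ∎)
  where
  open EquationalReasoning
  P₀↔⊤ : P zero ↔ ⊤
  P₀↔⊤ = mk↔ₛ′ _ (λ _ → q) (λ _ → refl) (irr q)
... | m , e | no ¬q = m , (begin
  Σ (Fin (suc N)) P              ↔⟨ Σ-Fin-suc ⟩
  (P zero ⊎ Σ (Fin N) (P ∘ suc)) ↔⟨ ⊎-cong (↔-trans P₀↔⊥ (↔-sym 0↔⊥)) e ⟩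
  (Fin 0 ⊎ Fin m)                ↔⟨ +↔⊎ ⟨
  Fin m                          ∎)
  where
  open EquationalReasoning
  P₀↔⊥ : P zero ↔ ⊥
  P₀↔⊥ = mk↔ₛ′ ¬q (λ ()) (λ ()) (⊥-elim ∘ ¬q)

fibre↔ : UIP B → (e : A ↔ (B × X)) (b : B) → X ↔ Σ A (λ a → proj₁ (Inverse.to e a) ≡ b)
fibre↔ uip e b = mk↔ₛ′
  (λ x → from (b , x) , cong proj₁ (strictlyInverseˡ (b , x)))
  (λ (a , _) → proj₂ (to a))
  (λ (a , q) → Σ-≡ uip (trans (cong (λ c → from (c , proj₂ (to a))) (sym q)) (strictlyInverseʳ a)))
  (λ x → cong proj₂ (strictlyInverseˡ (b , x)))
  where open Inverse e

divide-↔ : Fin N ↔ (Fin (suc n) × X) → X ↔ Fin (N / suc n)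
divide-↔ {N} {n} {X} e with Σ-Fin-finite N (λ i → proj₁ (Inverse.to e i) ≟ zero) Fin-UIP
... | m , fibre↔Fin = begin
  X               ↔⟨ X↔Fin[m] ⟩
  Fin m           ↔⟨ Fin-cong N/suc[n]≡m ⟨
  Fin (N / suc n) ∎
  where
  open EquationalReasoning
  X↔Fin[m] : X ↔ Fin m
  X↔Fin[m] = ↔-trans (fibre↔ Fin-UIP e zero) fibre↔Fin
  N≡m*suc[n] : N ≡ m * suc n
  N≡m*suc[n] = ↔⇒≡ (begin
    Fin N                 ↔⟨ e ⟩
    (Fin (suc n) × X)     ↔⟨ ×-cong ↔-refl X↔Fin[m] ⟩
    (Fin (suc n) × Fin m) ↔⟨ *↔× ⟨
    Fin (suc n * m)       ≡⟨ cong Fin (ℕ.*-comm (suc n) m) ⟩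
    Fin (m * suc n)       ∎)
  N/suc[n]≡m : N / suc n ≡ m
  N/suc[n]≡m = trans (cong (_/ suc n) N≡m*suc[n]) (m*n/n≡m m (suc n))

-- Binomial counts

trues : List Bool → ℕ
trues []           = 0
trues (true ∷ bs)  = suc (trues bs)
trues (false ∷ bs) = trues bs

BitStrings : ℕ → ℕ → Set
BitStrings n k = Σ (List Bool) λ bs → length bs ≡ n × trues bs ≡ k

BitStrings↔Fin[C] : ∀ n k → BitStrings n k ↔ Fin (n C k)
BitStrings↔Fin[C] zero zero = ↔-trans
  (mk↔ₛ′ _ (λ _ → [] , refl , refl) (λ _ → refl) (λ { ([] , refl , refl) → refl }))
  (↔-sym 1↔⊤)
BitStrings↔Fin[C] zero (suc k) = ↔-trans
  (mk↔ₛ′ (λ { ([] , _ , ()) }) (λ ()) (λ ()) (λ { ([] , _ , ()) }))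
  (↔-sym 0↔⊥)
BitStrings↔Fin[C] (suc n) zero = ↔-trans
  (mk↔ₛ′ (λ { (false ∷ bs , l , t) → bs , suc-injective l , t })
         (λ (bs , l , t) → false ∷ bs , cong suc l , t)
         (λ _ → Σ-≡ ℕ²-irrelevant refl)
         (λ { (false ∷ bs , l , t) → Σ-≡ ℕ²-irrelevant refl }))
  (BitStrings↔Fin[C] n zero)
BitStrings↔Fin[C] (suc n) (suc k) = begin
  BitStrings (suc n) (suc k)               ↔⟨ split ⟩
  (BitStrings n k ⊎ BitStrings n (suc k))  ↔⟨ ⊎-cong (BitStrings↔Fin[C] n k) (BitStrings↔Fin[C] n (suc k)) ⟩
  (Fin (n C k) ⊎ Fin (n C suc k))          ↔⟨ +↔⊎ ⟨
  Fin (n C k + n C suc k)                  ≡⟨ cong Fin (nCk+nC[k+1]≡[n+1]C[k+1] n k) ⟩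
  Fin (suc n C suc k)                      ∎
  where
  open EquationalReasoning
  split : BitStrings (suc n) (suc k) ↔ (BitStrings n k ⊎ BitStrings n (suc k))
  split = mk↔ₛ′
    (λ { (true ∷ bs , l , t)  → inj₁ (bs , suc-injective l , suc-injective t)
       ; (false ∷ bs , l , t) → inj₂ (bs , suc-injective l , t) })
    (λ { (inj₁ (bs , l , t)) → true ∷ bs , cong suc l , cong suc t
       ; (inj₂ (bs , l , t)) → false ∷ bs , cong suc l , t })
    (λ { (inj₁ _) → cong inj₁ (Σ-≡ ℕ²-irrelevant refl)
       ; (inj₂ _) → cong inj₂ (Σ-≡ ℕ²-irrelevant refl) })
    (λ { (true ∷ _ , _)  → Σ-≡ ℕ²-irrelevant refl
       ; (false ∷ _ , _) → Σ-≡ ℕ²-irrelevant refl })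

Compositions : ℕ → ℕ → Set
Compositions p s = Σ (List ℕ) λ w → length w ≡ p × sum w ≡ s

-- Stars and bars, with the truncated subtraction making the case p = 0 come out right.
Compositions↔Fin[C] : ∀ p s → Compositions p s ↔ Fin ((s + p ∸ 1) C s)
Compositions↔Fin[C] zero zero = ↔-trans
  (mk↔ₛ′ _ (λ _ → [] , refl , refl) (λ _ → refl) (λ { ([] , refl , refl) → refl }))
  (↔-sym 1↔⊤)
Compositions↔Fin[C] zero (suc s) = begin
  Compositions zero (suc s) ↔⟨ mk↔ₛ′ (λ { ([] , _ , ()) }) (λ ()) (λ ()) (λ { ([] , _ , ()) }) ⟩
  ⊥                         ↔⟨ 0↔⊥ ⟨
  Fin 0                     ≡⟨ cong Fin (sym (k>n⇒nCk≡0 (s≤s (ℕ.≤-reflexive (ℕ.+-identityʳ s))))) ⟩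
  Fin ((s + 0) C suc s)     ∎
  where open EquationalReasoning
Compositions↔Fin[C] (suc p) zero = ↔-trans
  (mk↔ₛ′ (λ { (zero ∷ w , l , t) → w , suc-injective l , t })
         (λ (w , l , t) → zero ∷ w , cong suc l , t)
         (λ _ → Σ-≡ ℕ²-irrelevant refl)
         (λ { (zero ∷ w , l , t) → Σ-≡ ℕ²-irrelevant refl }))
  (Compositions↔Fin[C] p zero)
Compositions↔Fin[C] (suc p) (suc s) = begin
  Compositions (suc p) (suc s)                     ↔⟨ split ⟩
  (Compositions p (suc s) ⊎ Compositions (suc p) s)
    ↔⟨ ⊎-cong (Compositions↔Fin[C] p (suc s)) (Compositions↔Fin[C] (suc p) s) ⟩
  (Fin ((s + p) C suc s) ⊎ Fin ((s + suc p ∸ 1) C s))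
    ≡⟨ cong (λ n → Fin ((s + p) C suc s) ⊎ Fin ((n ∸ 1) C s)) (+-suc s p) ⟩
  (Fin ((s + p) C suc s) ⊎ Fin ((s + p) C s))
    ↔⟨ +↔⊎ ⟨
  Fin ((s + p) C suc s + (s + p) C s)
    ≡⟨ cong Fin (trans (+-comm ((s + p) C suc s) _) (nCk+nC[k+1]≡[n+1]C[k+1] (s + p) s)) ⟩
  Fin (suc (s + p) C suc s)
    ≡⟨ cong (λ n → Fin (n C suc s)) (sym (+-suc s p)) ⟩
  Fin ((s + suc p) C suc s)
    ∎
  where
  open EquationalReasoning
  split : Compositions (suc p) (suc s) ↔ (Compositions p (suc s) ⊎ Compositions (suc p) s)
  split = mk↔ₛ′
    (λ { (zero ∷ w , l , t)  → inj₁ (w , suc-injective l , t)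
       ; (suc a ∷ w , l , t) → inj₂ (a ∷ w , l , suc-injective t) })
    (λ { (inj₁ (w , l , t))     → zero ∷ w , cong suc l , t
       ; (inj₂ (a ∷ w , l , t)) → suc a ∷ w , l , cong suc t })
    (λ { (inj₁ _)         → cong inj₁ (Σ-≡ ℕ²-irrelevant refl)
       ; (inj₂ (_ ∷ _ , _)) → cong inj₂ (Σ-≡ ℕ²-irrelevant refl) })
    (λ { (zero ∷ _ , _)  → Σ-≡ ℕ²-irrelevant refl
       ; (suc _ ∷ _ , _) → Σ-≡ ℕ²-irrelevant refl })

-- Łukasiewicz codes

data Letter : Set where
  leafˡ : Letter
  nodeˡ : (m : ℕ) → Fin (suc m) → Letter

arity : Letter → ℕ
arity leafˡ       = 0
arity (nodeˡ m _) = suc m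

leafCount : List Letter → ℕ
leafCount []              = 0
leafCount (leafˡ ∷ w)     = suc (leafCount w)
leafCount (nodeˡ _ _ ∷ w) = leafCount w

-- Reading w with a subtrees still to be read leaves pending a w of them, or nothing when
-- some letter of w comes after all of them are complete.
pending : ℕ → List Letter → Maybe ℕ
pending a       []      = just a
pending zero    (_ ∷ _) = nothing
pending (suc a) (x ∷ w) = pending (arity x + a) w

IsCode : List Letter → Set
IsCode w = pending 1 w ≡ just 0

mutual
  encode : DTree → List Letter
  encode leaf          = leafˡ ∷ []
  encode (node m ts d) = nodeˡ m d ∷ encodes ts

  encodes : ∀ {c} → Vec DTree c → List Letter
  encodes []       = []
  encodes (t ∷ ts) = encode t ++ encodes ts

build : (x : Letter) → Vec DTree (arity x) → DTree
build leafˡ       [] = leaf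
build (nodeˡ m d) ts = node m ts d

-- Padding with leaves when the word runs out makes decoding total.
decodes : (c : ℕ) → List Letter → Vec DTree c
decodes zero    _       = []
decodes (suc c) []      = replicate _ leaf
decodes (suc c) (x ∷ w) = build x (takeᵥ (arity x) ts) ∷ dropᵥ (arity x) ts
  where ts = decodes (arity x + c) w

decode : List Letter → DTree
decode w = head (decodes 1 w)

takeᵥ-dropᵥ-++ᵥ : ∀ {A : Set} {m n} (xs : Vec A m) (ys : Vec A n) →
               takeᵥ m (xs ++ᵥ ys) ≡ xs × dropᵥ m (xs ++ᵥ ys) ≡ ys
takeᵥ-dropᵥ-++ᵥ {m = m} xs ys = ++-injective (takeᵥ m (xs ++ᵥ ys)) xs (take++drop≡idᵥ m (xs ++ᵥ ys))

mutual
  decodes-encode : ∀ t c w → decodes (suc c) (encode t ++ w) ≡ t ∷ decodes c w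
  decodes-encode leaf          c w = refl
  decodes-encode (node m ts d) c w rewrite decodes-encodes ts c w =
    let t≡ts , d≡rest = takeᵥ-dropᵥ-++ᵥ ts (decodes c w)
    in cong₂ (λ us vs → node m us d ∷ vs) t≡ts d≡rest

  decodes-encodes : ∀ {a} (ts : Vec DTree a) c w → decodes (a + c) (encodes ts ++ w) ≡ ts ++ᵥ decodes c w
  decodes-encodes []               c w = refl
  decodes-encodes {suc a} (t ∷ ts) c w = begin
    decodes (suc (a + c)) ((encode t ++ encodes ts) ++ w) ≡⟨ cong (decodes _) (++-assoc (encode t) _ w) ⟩
    decodes (suc (a + c)) (encode t ++ encodes ts ++ w)   ≡⟨ decodes-encode t (a + c) _ ⟩
    t ∷ decodes (a + c) (encodes ts ++ w)                 ≡⟨ cong (t ∷_) (decodes-encodes ts c w) ⟩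
    t ∷ ts ++ᵥ decodes c w                                ∎
    where open ≡-Reasoning

mutual
  pending-encode : ∀ t c w → pending (suc c) (encode t ++ w) ≡ pending c w
  pending-encode leaf          c w = refl
  pending-encode (node m ts d) c w = pending-encodes ts c w

  pending-encodes : ∀ {a} (ts : Vec DTree a) c w → pending (a + c) (encodes ts ++ w) ≡ pending c w
  pending-encodes []               c w = refl
  pending-encodes {suc a} (t ∷ ts) c w = begin
    pending (suc (a + c)) ((encode t ++ encodes ts) ++ w) ≡⟨ cong (pending _) (++-assoc (encode t) _ w) ⟩
    pending (suc (a + c)) (encode t ++ encodes ts ++ w)   ≡⟨ pending-encode t (a + c) _ ⟩
    pending (a + c) (encodes ts ++ w)                     ≡⟨ pending-encodes ts c w ⟩
    pending c w                                           ∎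
    where open ≡-Reasoning

encodes-++ : ∀ {a b} (ts : Vec DTree a) (us : Vec DTree b) → encodes (ts ++ᵥ us) ≡ encodes ts ++ encodes us
encodes-++ []       us = refl
encodes-++ (t ∷ ts) us = trans (cong (encode t ++_) (encodes-++ ts us)) (sym (++-assoc (encode t) _ _))

encode-build : ∀ x (ts : Vec DTree (arity x)) → encode (build x ts) ≡ x ∷ encodes ts
encode-build leafˡ       [] = refl
encode-build (nodeˡ m d) ts = refl

encodes-decodes : ∀ c w → pending c w ≡ just 0 → encodes (decodes c w) ≡ w
encodes-decodes zero    []      _  = refl
encodes-decodes (suc c) (x ∷ w) eq = begin
  encode (build x children) ++ encodes rest ≡⟨ cong (_++ encodes rest) (encode-build x children) ⟩
  x ∷ encodes children ++ encodes rest      ≡⟨ cong (x ∷_) (encodes-++ children rest) ⟨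
  x ∷ encodes (children ++ᵥ rest)           ≡⟨ cong (λ us → x ∷ encodes us) (take++drop≡idᵥ (arity x) ts) ⟩
  x ∷ encodes ts                            ≡⟨ cong (x ∷_) (encodes-decodes (arity x + c) w eq) ⟩
  x ∷ w                                     ∎
  where
  open ≡-Reasoning
  ts : Vec DTree (arity x + c)
  ts = decodes (arity x + c) w
  children : Vec DTree (arity x)
  children = takeᵥ (arity x) ts
  rest : Vec DTree c
  rest = dropᵥ (arity x) ts

encode-isCode : ∀ t → IsCode (encode t)
encode-isCode t = trans (cong (pending 1) (sym (++-identityʳ (encode t)))) (pending-encode t 0 [])

decode-encode : ∀ t → decode (encode t) ≡ t
decode-encode t = cong head (trans (cong (decodes 1) (sym (++-identityʳ (encode t)))) (decodes-encode t 0 []))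

encode-decode : ∀ w → IsCode w → encode (decode w) ≡ w
encode-decode w isCode with decodes 1 w | encodes-decodes 1 w isCode
... | t ∷ [] | encodes≡w = trans (sym (++-identityʳ (encode t))) encodes≡w

leafCount-++ : ∀ u v → leafCount (u ++ v) ≡ leafCount u + leafCount v
leafCount-++ []              v = refl
leafCount-++ (leafˡ ∷ u)     v = cong suc (leafCount-++ u v)
leafCount-++ (nodeˡ _ _ ∷ u) v = leafCount-++ u v

mutual
  length-encode : ∀ t → length (encode t) ≡ size t
  length-encode leaf          = refl
  length-encode (node m ts d) = cong suc (length-encodes ts)

  length-encodes : ∀ {a} (ts : Vec DTree a) → length (encodes ts) ≡ sizes ts
  length-encodes []       = refl
  length-encodes (t ∷ ts) = trans (length-++ (encode t)) (cong₂ _+_ (length-encode t) (length-encodes ts))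

mutual
  leafCount-encode : ∀ t → leafCount (encode t) ≡ leaves t
  leafCount-encode leaf          = refl
  leafCount-encode (node m ts d) = leafCount-encodes ts

  leafCount-encodes : ∀ {a} (ts : Vec DTree a) → leafCount (encodes ts) ≡ leavesV ts
  leafCount-encodes []       = refl
  leafCount-encodes (t ∷ ts) = trans (leafCount-++ (encode t) _) (cong₂ _+_ (leafCount-encode t) (leafCount-encodes ts))

Trees : ℕ → ℕ → Set
Trees n k = Σ DTree λ t → size t ≡ n × leaves t ≡ k

Codes : ℕ → ℕ → Set
Codes n k = Σ (List Letter) λ w → length w ≡ n × IsCode w × leafCount w ≡ k

IsCode-irrelevant : ∀ {w} → Irrelevant (IsCode w)
IsCode-irrelevant = Decidable⇒UIP.≡-irrelevant (Maybe.≡-dec ℕ._≟_)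

Codes-irrelevant : ∀ {w} → Irrelevant (length w ≡ n × IsCode w × leafCount w ≡ k)
Codes-irrelevant {w = w} = ×-irrelevant ℕ.≡-irrelevant (×-irrelevant (IsCode-irrelevant {w}) ℕ.≡-irrelevant)

Trees↔Codes : ∀ n k → Trees n k ↔ Codes n k
Trees↔Codes n k = mk↔ₛ′
  (λ (t , sz , lv) → encode t , trans (length-encode t) sz , encode-isCode t , trans (leafCount-encode t) lv)
  (λ (w , len , isCode , lc) → decode w
     , trans (sym (length-encode (decode w))) (trans (cong length (encode-decode w isCode)) len)
     , trans (sym (leafCount-encode (decode w))) (trans (cong leafCount (encode-decode w isCode)) lc))
  (λ (w , _ , isCode , _) → Σ-≡ (λ {w} → Codes-irrelevant {w = w}) (encode-decode w isCode))
  (λ (t , _) → Σ-≡ ℕ²-irrelevant (decode-encode t))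

-- The cycle lemma

totalArity : List Letter → ℕ
totalArity w = sum (map arity w)

totalArity-++ : ∀ u v → totalArity (u ++ v) ≡ totalArity u + totalArity v
totalArity-++ u v = trans (cong sum (map-++ arity u v)) (sum-++ (map arity u) _)

pending-++ : ∀ a u v {b} → pending a u ≡ just b → pending a (u ++ v) ≡ pending b v
pending-++ a       []      v refl = refl
pending-++ (suc a) (x ∷ u) v eq   = pending-++ (arity x + a) u v eq

pending-+ : ∀ a w t {b} → pending a w ≡ just b → pending (a + t) w ≡ just (b + t)
pending-+ a       []      t refl = refl
pending-+ (suc a) (x ∷ w) t eq   =
  trans (cong (λ c → pending c w) (sym (ℕ.+-assoc (arity x) a t))) (pending-+ (arity x + a) w t eq)

pending-balance : ∀ a w {b} → pending a w ≡ just b → a + totalArity w ≡ b + length w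
pending-balance a       []      refl = refl
pending-balance (suc a) (x ∷ w) {b} eq = begin
  suc a + (arity x + totalArity w) ≡⟨ cong suc (rearrange a (arity x) (totalArity w)) ⟩
  suc (arity x + a + totalArity w) ≡⟨ cong suc (pending-balance (arity x + a) w eq) ⟩
  suc (b + length w)               ≡⟨ +-suc b (length w) ⟨
  b + suc (length w)               ∎
  where
  open ≡-Reasoning
  rearrange : ∀ a d t → a + (d + t) ≡ d + a + t
  rearrange = solve-∀

code-balance : ∀ w → IsCode w → suc (totalArity w) ≡ length w
code-balance w = pending-balance 1 w

pending-prefix : ∀ a u x v {c} → pending a (u ++ x ∷ v) ≡ just c → ∃[ b ] pending a u ≡ just (suc b)
pending-prefix (suc a) []      x v eq = a , refl
pending-prefix (suc a) (y ∷ u) x v eq = pending-prefix (arity y + a) u x v eq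

proper-prefix-of-code : ∀ u x v → IsCode (u ++ x ∷ v) → length u ≤ totalArity u
proper-prefix-of-code u x v isCode =
  let b , u-pending = pending-prefix 1 u x v isCode
  in subst (length u ≤_) (sym (suc-injective (pending-balance 1 u u-pending))) (ℕ.m≤n+m (length u) b)

-- A code has one more letter than its total arity, while a proper prefix has at most as many.
code-conjugates-trivial : ∀ u v → IsCode (u ++ v) → IsCode (v ++ u) → u ≡ [] ⊎ v ≡ []
code-conjugates-trivial []      v       _     _     = inj₁ refl
code-conjugates-trivial (x ∷ u) []      _     _     = inj₂ refl
code-conjugates-trivial (x ∷ u) (y ∷ v) uv-code vu-code = ⊥-elim (ℕ.<-irrefl refl (begin-strict
  length (x ∷ u ++ y ∷ v)                             ≡⟨ length-++ (x ∷ u) ⟩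
  length (x ∷ u) + length (y ∷ v)                     ≤⟨ ℕ.+-mono-≤ (proper-prefix-of-code (x ∷ u) y v uv-code)
                                                                      (proper-prefix-of-code (y ∷ v) x u vu-code) ⟩
  totalArity (x ∷ u) + totalArity (y ∷ v)             ≡⟨ totalArity-++ (x ∷ u) (y ∷ v) ⟨
  totalArity (x ∷ u ++ y ∷ v)                         <⟨ ℕ.n<1+n _ ⟩
  suc (totalArity (x ∷ u ++ y ∷ v))                   ≡⟨ code-balance (x ∷ u ++ y ∷ v) uv-code ⟩
  length (x ∷ u ++ y ∷ v)                             ∎))
  where open ℕ.≤-Reasoning

record CodeConjugate (u : List Letter) : Set where
  constructor codeConjugate
  field
    s p      : List Letter
    s≢[]     : s ≢ []
    u≡s++p   : u ≡ s ++ p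
    p++sCode : IsCode (p ++ s)

-- For balanced u the conservation law forces r = e, and then v ++ c is a code when r > 0.
record Decomposition (u : List Letter) : Set where
  constructor decomposition
  field
    r e    : ℕ
    c v    : List Letter
    u≡c++v : u ≡ c ++ v
    c-done : pending r c ≡ just 0
    v-read : pending 1 v ≡ just e

decompose : ∀ u → Decomposition u
decompose []      = decomposition 0 1 [] [] refl refl refl
decompose (x ∷ u) with decompose u
... | decomposition r e c v refl c-done v-read with ℕ.≤-<-connex (arity x) r
...   | inj₁ x≤r =
  let d , x+d≡r = ℕ.m≤n⇒∃[o]m+o≡n x≤r
  in decomposition (suc d) e (x ∷ c) v refl (subst (λ a → pending a c ≡ just 0) (sym x+d≡r) c-done) v-read
...   | inj₂ r<x =
  let t , 1+r+t≡x = ℕ.m≤n⇒∃[o]m+o≡n r<x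
  in decomposition 0 (e + t) [] (x ∷ c ++ v) refl refl (begin
    pending (arity x + 0) (c ++ v) ≡⟨ cong (λ a → pending a (c ++ v)) (trans (ℕ.+-identityʳ _) (sym 1+r+t≡x)) ⟩
    pending (suc r + t) (c ++ v)   ≡⟨ cong (λ a → pending a (c ++ v)) (+-suc r t) ⟨
    pending (r + suc t) (c ++ v)   ≡⟨ pending-++ (r + suc t) c v (pending-+ r c (suc t) c-done) ⟩
    pending (suc t) v              ≡⟨ pending-+ 1 v t v-read ⟩
    just (e + t)                   ∎)
  where open ≡-Reasoning

decomposition-r≡e : ∀ {u} → suc (totalArity u) ≡ length u →
                    (d : Decomposition u) → Decomposition.r d ≡ Decomposition.e d
decomposition-r≡e bal (decomposition r e c v refl c-done v-read) = ℕ.+-cancelʳ-≡ _ r e (begin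
  r + (length c + length v)                    ≡⟨ cong (r +_) (trans (cong suc (sym (totalArity-++ c v))) (trans bal (length-++ c))) ⟨
  r + suc (totalArity c + totalArity v)        ≡⟨ rearrange r (totalArity c) (totalArity v) ⟩
  (r + totalArity c) + suc (totalArity v)      ≡⟨ cong₂ _+_ (pending-balance r c c-done) (pending-balance 1 v v-read) ⟩
  length c + (e + length v)                    ≡⟨ rearrange′ (length c) e (length v) ⟩
  e + (length c + length v)                    ∎)
  where
  open ≡-Reasoning
  rearrange : ∀ r a b → r + suc (a + b) ≡ (r + a) + suc b
  rearrange = solve-∀
  rearrange′ : ∀ a e b → a + (e + b) ≡ e + (a + b)
  rearrange′ = solve-∀

decomposition⇒codeConjugate : ∀ {u} → suc (totalArity u) ≡ length u →
  (d : Decomposition u) → Decomposition.r d ≡ Decomposition.e d → CodeConjugate u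
decomposition⇒codeConjugate bal (decomposition zero .zero [] v refl _ v-read) refl =
  codeConjugate v [] (λ v≡[] → ℕ.1+n≢0 (trans bal (cong length v≡[]))) (sym (++-identityʳ v)) v-read
decomposition⇒codeConjugate bal (decomposition (suc r) .(suc r) c v refl c-done v-read) refl =
  codeConjugate c v (λ { refl → case c-done of λ () }) refl (trans (pending-++ 1 v c v-read) c-done)

codeConjugate-exists : ∀ u → suc (totalArity u) ≡ length u → CodeConjugate u
codeConjugate-exists u bal = decomposition⇒codeConjugate bal (decompose u) (decomposition-r≡e bal (decompose u))

++-equidivisible : ∀ {A : Set} (s₁ p₁ s₂ p₂ : List A) → s₁ ++ p₁ ≡ s₂ ++ p₂ →
  (∃[ b ] s₂ ≡ s₁ ++ b × p₁ ≡ b ++ p₂) ⊎ (∃[ b ] s₁ ≡ s₂ ++ b × p₂ ≡ b ++ p₁)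
++-equidivisible []       p₁ s₂       p₂ eq = inj₁ (s₂ , refl , eq)
++-equidivisible (x ∷ s₁) p₁ []       p₂ eq = inj₂ (x ∷ s₁ , refl , sym eq)
++-equidivisible (x ∷ s₁) p₁ (y ∷ s₂) p₂ eq with refl , eq′ ← ∷-injective eq
  with ++-equidivisible s₁ p₁ s₂ p₂ eq′
... | inj₁ (b , refl , refl) = inj₁ (b , refl , refl)
... | inj₂ (b , refl , refl) = inj₂ (b , refl , refl)

codeConjugate-extension : ∀ s b p → s ≢ [] → IsCode ((b ++ p) ++ s) → IsCode (p ++ s ++ b) → b ≡ []
codeConjugate-extension s b p s≢[] code₁ code₂
  with code-conjugates-trivial b (p ++ s)
         (subst IsCode (++-assoc b p s) code₁) (subst IsCode (sym (++-assoc p s b)) code₂)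
... | inj₁ b≡[]    = b≡[]
... | inj₂ p++s≡[] = ⊥-elim (s≢[] (suffix-of-[] p p++s≡[]))
  where
  suffix-of-[] : ∀ p → p ++ s ≡ [] → s ≡ []
  suffix-of-[] [] eq = eq

codeConjugate-unique : ∀ {u} (c₁ c₂ : CodeConjugate u) →
  CodeConjugate.s c₁ ≡ CodeConjugate.s c₂ × CodeConjugate.p c₁ ≡ CodeConjugate.p c₂
codeConjugate-unique (codeConjugate s₁ p₁ s₁≢[] refl code₁) (codeConjugate s₂ p₂ s₂≢[] eq code₂)
  with ++-equidivisible s₁ p₁ s₂ p₂ eq
... | inj₁ (b , refl , refl) with refl ← codeConjugate-extension s₁ b p₂ s₁≢[] code₁ code₂ =
  sym (++-identityʳ s₁) , refl
... | inj₂ (b , refl , refl) with refl ← codeConjugate-extension s₂ b p₁ s₂≢[] code₂ code₁ =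
  ++-identityʳ s₂ , refl

take-drop-length-++ : ∀ {A : Set} (p s : List A) →
                      take (length p) (p ++ s) ≡ p × drop (length p) (p ++ s) ≡ s
take-drop-length-++ []      s = refl , refl
take-drop-length-++ (x ∷ p) s = let t , d = take-drop-length-++ p s in cong (x ∷_) t , d

-- A position i < n of a word of length n cuts it as p ++ s with length p = i, i.e. with s nonempty.
module Cutting {A : Set} (P : List A → Set) (P-irrelevant : ∀ {w} → Irrelevant (P w)) where

  Words : ℕ → Set
  Words n = Σ (List A) λ w → length w ≡ n × P w

  IsCut : ℕ → List A × List A → Set
  IsCut n (p , s) = (length (p ++ s) ≡ n × P (p ++ s)) × length p < n

  Cuts : ℕ → Set
  Cuts n = Σ (List A × List A) (IsCut n)

  IsCut-irrelevant : ∀ {n ps} → Irrelevant (IsCut n ps)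
  IsCut-irrelevant {ps = _ , _} = ×-irrelevant (×-irrelevant ℕ.≡-irrelevant P-irrelevant) ℕ.<-irrelevant

  Fin×Words↔Cuts : ∀ n → (Fin n × Words n) ↔ Cuts n
  Fin×Words↔Cuts n = mk↔ₛ′ to from to∘from from∘to
    where
    length-take-toℕ : ∀ (i : Fin n) w → length w ≡ n → length (take (toℕ i) w) ≡ toℕ i
    length-take-toℕ i w len = trans (length-take (toℕ i) w)
                                    (ℕ.m≤n⇒m⊓n≡m (ℕ.<⇒≤ (subst (toℕ i <_) (sym len) (toℕ<n i))))

    to : Fin n × Words n → Cuts n
    to (i , w , len , pw) = (take (toℕ i) w , drop (toℕ i) w)
      , subst (λ w → length w ≡ n × P w) (sym (take++drop≡id (toℕ i) w)) (len , pw)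
      , subst (_< n) (sym (length-take-toℕ i w len)) (toℕ<n i)

    from : Cuts n → Fin n × Words n
    from ((p , s) , words , p<n) = fromℕ< p<n , p ++ s , words

    to∘from : ∀ c → to (from c) ≡ c
    to∘from ((p , s) , _ , p<n) = Σ-≡ (λ {ps} → IsCut-irrelevant {ps = ps}) (begin
      (take j (p ++ s) , drop j (p ++ s))
        ≡⟨ cong (λ j → take j (p ++ s) , drop j (p ++ s)) (toℕ-fromℕ< p<n) ⟩
      (take (length p) (p ++ s) , drop (length p) (p ++ s))
        ≡⟨ cong₂ _,_ (proj₁ (take-drop-length-++ p s)) (proj₂ (take-drop-length-++ p s)) ⟩
      (p , s)
        ∎)
      where
      open ≡-Reasoning
      j : ℕ
      j = toℕ (fromℕ< p<n)

    from∘to : ∀ x → from (to x) ≡ x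
    from∘to (i , w , len , _) = cong₂ _,_
      (toℕ-injective (trans (toℕ-fromℕ< _) (length-take-toℕ i w len)))
      (Σ-≡ (×-irrelevant ℕ.≡-irrelevant P-irrelevant) (take++drop≡id (toℕ i) w))

≢[]⇒length-< : ∀ {A : Set} (p s : List A) → s ≢ [] → length p < length (s ++ p)
≢[]⇒length-< p []      s≢[] = ⊥-elim (s≢[] refl)
≢[]⇒length-< p (x ∷ s) _    = s≤s (length-++-≤ʳ p {s})

length-<⇒≢[] : ∀ {A : Set} (p s : List A) → length p < length (p ++ s) → s ≢ []
length-<⇒≢[] p s p<ps refl = ℕ.<-irrefl (cong length (sym (++-identityʳ p))) p<ps

conjugate-invariant : ∀ {A : Set} (f : List A → ℕ) → (∀ u v → f (u ++ v) ≡ f u + f v) →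
                      ∀ u v → f (u ++ v) ≡ f (v ++ u)
conjugate-invariant f f-++ u v = trans (f-++ u v) (trans (+-comm (f u) (f v)) (sym (f-++ v u)))

Balanced : ℕ → ℕ → Set
Balanced n k = Σ (List Letter) λ u → length u ≡ n × leafCount u ≡ k × suc (totalArity u) ≡ n

Balanced-irrelevant : ∀ {u} → Irrelevant (length u ≡ n × leafCount u ≡ k × suc (totalArity u) ≡ n)
Balanced-irrelevant = ×-irrelevant ℕ.≡-irrelevant ℕ²-irrelevant

module _ (k : ℕ) where
  open Cutting (λ w → IsCode w × leafCount w ≡ k) (λ {w} → ×-irrelevant (IsCode-irrelevant {w}) ℕ.≡-irrelevant) public

  -- Cutting a code and swapping the two pieces; by the cycle lemma exactly one cut of a code
  -- yields any given balanced word.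
  Cuts↔Balanced : ∀ n → Cuts n ↔ Balanced n k
  Cuts↔Balanced n = mk↔ₛ′ to from to∘from from∘to
    where
    leafCount-conj : ∀ u v → leafCount (u ++ v) ≡ leafCount (v ++ u)
    leafCount-conj = conjugate-invariant leafCount leafCount-++
    totalArity-conj : ∀ u v → totalArity (u ++ v) ≡ totalArity (v ++ u)
    totalArity-conj = conjugate-invariant totalArity totalArity-++

    to : Cuts n → Balanced n k
    to ((p , s) , (len , code , lc) , _) = s ++ p
      , trans (length-++-comm s p) len
      , trans (leafCount-conj s p) lc
      , trans (cong suc (totalArity-conj s p)) (trans (code-balance (p ++ s) code) len)

    fromConjugate : ∀ {u} → length u ≡ n → leafCount u ≡ k → CodeConjugate u → Cuts n
    fromConjugate len lc (codeConjugate s p s≢[] u≡s++p code) =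
      (p , s) , (trans (length-++-comm p s) len′ , code , trans (leafCount-conj p s) lc′)
      , subst (length p <_) len′ (≢[]⇒length-< p s s≢[])
      where
      len′ : length (s ++ p) ≡ n
      len′ = trans (cong length (sym u≡s++p)) len
      lc′ : leafCount (s ++ p) ≡ k
      lc′ = trans (cong leafCount (sym u≡s++p)) lc

    conjugateOf : (b : Balanced n k) → CodeConjugate (proj₁ b)
    conjugateOf (u , len , _ , bal) = codeConjugate-exists u (trans bal (sym len))

    from : Balanced n k → Cuts n
    from b@(_ , len , lc , _) = fromConjugate len lc (conjugateOf b)

    to∘from : ∀ b → to (from b) ≡ b
    to∘from b with conjugateOf b
    ... | codeConjugate s p s≢[] u≡s++p code = Σ-≡ (λ {u} → Balanced-irrelevant {u = u}) (sym u≡s++p)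

    fromConjugate-cut : ∀ {p s} {len : length (s ++ p) ≡ n} {lc : leafCount (s ++ p) ≡ k} →
                        s ≢ [] → IsCode (p ++ s) → (c : CodeConjugate (s ++ p)) →
                        proj₁ (fromConjugate len lc c) ≡ (p , s)
    fromConjugate-cut {p} {s} s≢[] code c@(codeConjugate _ _ _ _ _)
      with codeConjugate-unique c (codeConjugate s p s≢[] refl code)
    ... | refl , refl = refl

    from∘to : ∀ c → from (to c) ≡ c
    from∘to c@((p , s) , (len , code , lc) , p<n) = Σ-≡ (λ {ps} → IsCut-irrelevant {ps = ps})
      (fromConjugate-cut {len = trans (length-++-comm s p) len} {lc = trans (leafCount-conj s p) lc}
                         (length-<⇒≢[] p s (subst (length p <_) (sym len) p<n)) code (conjugateOf (to c)))

-- Balanced words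

NodeType : Set
NodeType = Σ ℕ λ m → Fin (suc m)

shape : List Letter → List Bool
shape []              = []
shape (leafˡ ∷ w)     = true ∷ shape w
shape (nodeˡ _ _ ∷ w) = false ∷ shape w

nodeTypes : List Letter → List NodeType
nodeTypes []              = []
nodeTypes (leafˡ ∷ w)     = nodeTypes w
nodeTypes (nodeˡ m d ∷ w) = (m , d) ∷ nodeTypes w

fill : List Bool → List NodeType → List Letter
fill []           v             = []
fill (true ∷ bs)  v             = leafˡ ∷ fill bs v
fill (false ∷ bs) []            = []
fill (false ∷ bs) ((m , d) ∷ v) = nodeˡ m d ∷ fill bs v

falses : List Bool → ℕ
falses []           = 0
falses (true ∷ bs)  = falses bs
falses (false ∷ bs) = suc (falses bs)

nodeWeight : List Letter → ℕ
nodeWeight w = sum (map proj₁ (nodeTypes w))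

fill-shape : ∀ w → fill (shape w) (nodeTypes w) ≡ w
fill-shape []              = refl
fill-shape (leafˡ ∷ w)     = cong (leafˡ ∷_) (fill-shape w)
fill-shape (nodeˡ m d ∷ w) = cong (nodeˡ m d ∷_) (fill-shape w)

shape-fill : ∀ bs v → length v ≡ falses bs → shape (fill bs v) ≡ bs × nodeTypes (fill bs v) ≡ v
shape-fill []           []            _  = refl , refl
shape-fill (true ∷ bs)  v             eq = let sh , nt = shape-fill bs v eq in cong (true ∷_) sh , nt
shape-fill (false ∷ bs) ((m , d) ∷ v) eq =
  let sh , nt = shape-fill bs v (suc-injective eq) in cong (false ∷_) sh , cong ((m , d) ∷_) nt

length-shape : ∀ w → length (shape w) ≡ length w
length-shape []              = refl
length-shape (leafˡ ∷ w)     = cong suc (length-shape w)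
length-shape (nodeˡ _ _ ∷ w) = cong suc (length-shape w)

trues-shape : ∀ w → trues (shape w) ≡ leafCount w
trues-shape []              = refl
trues-shape (leafˡ ∷ w)     = cong suc (trues-shape w)
trues-shape (nodeˡ _ _ ∷ w) = trues-shape w

length-nodeTypes : ∀ w → length (nodeTypes w) ≡ falses (shape w)
length-nodeTypes []              = refl
length-nodeTypes (leafˡ ∷ w)     = length-nodeTypes w
length-nodeTypes (nodeˡ _ _ ∷ w) = cong suc (length-nodeTypes w)

falses≡length∸trues : ∀ bs → falses bs ≡ length bs ∸ trues bs
falses≡length∸trues []           = refl
falses≡length∸trues (true ∷ bs)  = falses≡length∸trues bs
falses≡length∸trues (false ∷ bs) = trans (cong suc (falses≡length∸trues bs)) (sym (ℕ.+-∸-assoc 1 (trues≤length bs)))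
  where
  trues≤length : ∀ bs → trues bs ≤ length bs
  trues≤length []           = z≤n
  trues≤length (true ∷ bs)  = s≤s (trues≤length bs)
  trues≤length (false ∷ bs) = ℕ.m≤n⇒m≤1+n (trues≤length bs)

totalArity+leafCount : ∀ w → totalArity w + leafCount w ≡ length w + nodeWeight w
totalArity+leafCount []              = refl
totalArity+leafCount (leafˡ ∷ w)     = trans (+-suc (totalArity w) _) (cong suc (totalArity+leafCount w))
totalArity+leafCount (nodeˡ m _ ∷ w) = cong suc (begin
  m + totalArity w + leafCount w   ≡⟨ ℕ.+-assoc m _ _ ⟩
  m + (totalArity w + leafCount w) ≡⟨ cong (m +_) (totalArity+leafCount w) ⟩
  m + (length w + nodeWeight w)    ≡⟨ swap m (length w) (nodeWeight w) ⟩
  length w + (m + nodeWeight w)    ∎)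
  where
  open ≡-Reasoning
  swap : ∀ a b c → a + (b + c) ≡ b + (a + c)
  swap = solve-∀

Weighted : ℕ → ℕ → ℕ → Set
Weighted n k s = Σ (List Letter) λ u → length u ≡ n × leafCount u ≡ k × nodeWeight u ≡ s

Weighted-irrelevant : ∀ {n k s u} → Irrelevant (length u ≡ n × leafCount u ≡ k × nodeWeight u ≡ s)
Weighted-irrelevant = ×-irrelevant ℕ.≡-irrelevant ℕ²-irrelevant

Balanced↔Weighted : ∀ n k → Balanced n (suc k) ↔ Weighted n (suc k) k
Balanced↔Weighted n k = mk↔ₛ′
  (λ (u , len , lc , bal) → u , len , lc , ℕ.+-cancelˡ-≡ n _ _ (begin
     n + nodeWeight u        ≡⟨ identity u len lc ⟨
     totalArity u + suc k    ≡⟨ +-suc (totalArity u) k ⟩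
     suc (totalArity u) + k  ≡⟨ cong (_+ k) bal ⟩
     n + k                   ∎))
  (λ (u , len , lc , nw) → u , len , lc , ℕ.+-cancelʳ-≡ k _ _ (begin
     suc (totalArity u) + k  ≡⟨ +-suc (totalArity u) k ⟨
     totalArity u + suc k    ≡⟨ identity u len lc ⟩
     n + nodeWeight u        ≡⟨ cong (n +_) nw ⟩
     n + k                   ∎))
  (λ _ → Σ-≡ (λ {u} → Weighted-irrelevant {u = u}) refl)
  (λ _ → Σ-≡ (λ {u} → Balanced-irrelevant {u = u}) refl)
  where
  open ≡-Reasoning
  identity : ∀ u → length u ≡ n → leafCount u ≡ suc k → totalArity u + suc k ≡ n + nodeWeight u
  identity u len lc = trans (cong (totalArity u +_) (sym lc)) (trans (totalArity+leafCount u) (cong (_+ nodeWeight u) len))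

NodeData : ℕ → ℕ → Set
NodeData q s = Σ (List NodeType) λ v → length v ≡ q × sum (map proj₁ v) ≡ s

Weighted↔BitStrings×NodeData : ∀ n k s → Weighted n k s ↔ (BitStrings n k × NodeData (n ∸ k) s)
Weighted↔BitStrings×NodeData n k s = mk↔ₛ′ to from to∘from from∘to
  where
  falses≡n∸k : ∀ bs → length bs ≡ n → trues bs ≡ k → falses bs ≡ n ∸ k
  falses≡n∸k bs len tr = trans (falses≡length∸trues bs) (cong₂ _∸_ len tr)

  to : Weighted n k s → BitStrings n k × NodeData (n ∸ k) s
  to (u , len , lc , nw) =
    (shape u , len′ , tr′) , (nodeTypes u , trans (length-nodeTypes u) (falses≡n∸k (shape u) len′ tr′) , nw)
    where
    len′ : length (shape u) ≡ n
    len′ = trans (length-shape u) len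
    tr′ : trues (shape u) ≡ k
    tr′ = trans (trues-shape u) lc

  from : BitStrings n k × NodeData (n ∸ k) s → Weighted n k s
  from ((bs , len , tr) , (v , lv , wv)) =
    let sh , nt = shape-fill bs v (trans lv (sym (falses≡n∸k bs len tr)))
    in fill bs v
       , trans (sym (length-shape (fill bs v))) (trans (cong length sh) len)
       , trans (sym (trues-shape (fill bs v))) (trans (cong trues sh) tr)
       , trans (cong (sum ∘ map proj₁) nt) wv

  to∘from : ∀ x → to (from x) ≡ x
  to∘from ((bs , len , tr) , (v , lv , _)) =
    let sh , nt = shape-fill bs v (trans lv (sym (falses≡n∸k bs len tr)))
    in cong₂ _,_ (Σ-≡ ℕ²-irrelevant sh) (Σ-≡ ℕ²-irrelevant nt)

  from∘to : ∀ u → from (to u) ≡ u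
  from∘to (u , _) = Σ-≡ (λ {u} → Weighted-irrelevant {u = u}) (fill-shape u)

-- A node with m + 1 children, the d-th one distinguished, is recorded as the numbers d and m − d
-- of children before and after the distinguished one.
flatten : List NodeType → List ℕ
flatten []            = []
flatten ((m , d) ∷ v) = toℕ d ∷ (m ∸ toℕ d) ∷ flatten v

unflatten : List ℕ → List NodeType
unflatten (a ∷ b ∷ w) = (a + b , fromℕ< (s≤s (ℕ.m≤m+n a b))) ∷ unflatten w
unflatten _           = []

unflatten-flatten : ∀ v → unflatten (flatten v) ≡ v
unflatten-flatten []            = refl
unflatten-flatten ((m , d) ∷ v) = cong₂ _∷_ (nodeType-≡ (ℕ.m+[n∸m]≡n (s≤s⁻¹ (toℕ<n d)))) (unflatten-flatten v)
  where
  nodeType-≡ : ∀ {m′} (m′≡m : m′ ≡ m) .{lt : toℕ d < suc m′} → _≡_ {A = NodeType} (m′ , fromℕ< lt) (m , d)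
  nodeType-≡ refl = cong (m ,_) (fromℕ<-toℕ d _)

flatten-unflatten : ∀ q w → length w ≡ q * 2 → flatten (unflatten w) ≡ w
flatten-unflatten zero    []          _   = refl
flatten-unflatten (suc q) (a ∷ b ∷ w) len = begin
  toℕ d ∷ (a + b ∸ toℕ d) ∷ flatten (unflatten w) ≡⟨ cong (λ j → j ∷ (a + b ∸ j) ∷ _) (toℕ-fromℕ< _) ⟩
  a ∷ (a + b ∸ a) ∷ flatten (unflatten w)         ≡⟨ cong₂ (λ c w → a ∷ c ∷ w) (ℕ.m+n∸m≡n a b) (flatten-unflatten q w len′) ⟩
  a ∷ b ∷ w                                       ∎
  where
  open ≡-Reasoning
  d : Fin (suc (a + b))
  d = fromℕ< (s≤s (ℕ.m≤m+n a b))
  len′ : length w ≡ q * 2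
  len′ = suc-injective (suc-injective len)

length-flatten : ∀ v → length (flatten v) ≡ length v * 2
length-flatten []      = refl
length-flatten (_ ∷ v) = cong (λ l → suc (suc l)) (length-flatten v)

sum-flatten : ∀ v → sum (flatten v) ≡ sum (map proj₁ v)
sum-flatten []            = refl
sum-flatten ((m , d) ∷ v) = begin
  toℕ d + (m ∸ toℕ d + sum (flatten v)) ≡⟨ ℕ.+-assoc (toℕ d) _ _ ⟨
  toℕ d + (m ∸ toℕ d) + sum (flatten v) ≡⟨ cong₂ _+_ (ℕ.m+[n∸m]≡n (s≤s⁻¹ (toℕ<n d))) (sum-flatten v) ⟩
  m + sum (map proj₁ v)                 ∎
  where open ≡-Reasoning

NodeData↔Compositions : ∀ q s → NodeData q s ↔ Compositions (q * 2) s
NodeData↔Compositions q s = mk↔ₛ′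
  (λ (v , len , wt) → flatten v , trans (length-flatten v) (cong (_* 2) len) , trans (sum-flatten v) wt)
  (λ (w , len , sm) → let flat = flatten-unflatten q w len in unflatten w
     , ℕ.*-cancelʳ-≡ _ q 2 (trans (sym (length-flatten (unflatten w))) (trans (cong length flat) len))
     , trans (sym (sum-flatten (unflatten w))) (trans (cong sum flat) sm))
  (λ (w , len , _) → Σ-≡ ℕ²-irrelevant (flatten-unflatten q w len))
  (λ (v , _) → Σ-≡ ℕ²-irrelevant (unflatten-flatten v))

binomial-exponent : ∀ k q → k + q * 2 ∸ 1 ≡ 2 * (suc k + q) ∸ 2 ∸ suc k
binomial-exponent k q = begin
  k + q * 2 ∸ 1                       ≡⟨ ℕ.[m+n]∸[m+o]≡n∸o (2 + k) (k + q * 2) 1 ⟨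
  (2 + k) + (k + q * 2) ∸ (2 + k + 1) ≡⟨ cong₂ _∸_ (double k q) (ℕ.+-comm (2 + k) 1) ⟩
  2 * (suc k + q) ∸ (2 + suc k)       ≡⟨ ℕ.∸-+-assoc (2 * (suc k + q)) 2 (suc k) ⟨
  2 * (suc k + q) ∸ 2 ∸ suc k         ∎
  where
  open ≡-Reasoning
  double : ∀ k q → (2 + k) + (k + q * 2) ≡ 2 * (suc k + q)
  double = solve-∀

Fin×Codes↔Fin : ∀ n k → suc k ≤ n → (Fin n × Codes n (suc k)) ↔ Fin ((n C suc k) * ((2 * n ∸ 2 ∸ suc k) C k))
Fin×Codes↔Fin n k k<n = begin
  (Fin n × Codes n (suc k))                         ↔⟨ Fin×Words↔Cuts (suc k) n ⟩
  Cuts (suc k) n                                    ↔⟨ Cuts↔Balanced (suc k) n ⟩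
  Balanced n (suc k)                                ↔⟨ Balanced↔Weighted n k ⟩
  Weighted n (suc k) k                              ↔⟨ Weighted↔BitStrings×NodeData n (suc k) k ⟩
  (BitStrings n (suc k) × NodeData q k)             ↔⟨ ×-cong (BitStrings↔Fin[C] n (suc k)) (NodeData↔Compositions q k) ⟩
  (Fin (n C suc k) × Compositions (q * 2) k)        ↔⟨ ×-cong ↔-refl (Compositions↔Fin[C] (q * 2) k) ⟩
  (Fin (n C suc k) × Fin ((k + q * 2 ∸ 1) C k))     ≡⟨ cong (λ e → Fin (n C suc k) × Fin (e C k)) exponent ⟩
  (Fin (n C suc k) × Fin ((2 * n ∸ 2 ∸ suc k) C k)) ↔⟨ *↔× ⟨
  Fin ((n C suc k) * ((2 * n ∸ 2 ∸ suc k) C k))     ∎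
  where
  open EquationalReasoning
  q : ℕ
  q = n ∸ suc k
  exponent : k + q * 2 ∸ 1 ≡ 2 * n ∸ 2 ∸ suc k
  exponent = trans (binomial-exponent k q) (cong (λ n → 2 * n ∸ 2 ∸ suc k) (ℕ.m+[n∸m]≡n k<n))

mainTheorem1 : (n k : ℕ) → .{{_ : NonZero n}} → 1 ≤ k → k ≤ n →
    Fin (((n C k) * ((2 * n ∸ 2 ∸ k) C (k ∸ 1))) / n)
      ↔ Σ DTree (λ t → size t ≡ n × leaves t ≡ k)
mainTheorem1 (suc n) (suc k) _ k≤n = begin
  Fin (((suc n C suc k) * ((2 * suc n ∸ 2 ∸ suc k) C k)) / suc n) ↔⟨ divide-↔ (↔-sym (Fin×Codes↔Fin (suc n) k k≤n)) ⟨
  Codes (suc n) (suc k)                                           ↔⟨ Trees↔Codes (suc n) (suc k) ⟨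
  Trees (suc n) (suc k)                                           ∎
  where open EquationalReasoning
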